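{- Let $n\ge 4$ and $k\ge 1$ be integers. Then \[ \gamma_{[k]R}(C_6\Box P_n)\le 6(n-2)\left\lceil\frac{k+5}{5}\right\rceil+12\left\lceil\frac{k+3-\left\lceil\frac{k+5}{5}\right\rceil}{3}\right\rceil-2\left\lceil\frac n2\right\rceil . \] Moreover, $\gamma_{[k]R}(C_6\Box P_n)\le \frac{6nk+55n+4k-20}{5}$ if $n$ is even, and $\gamma_{[k]R}(C_6\Box P_n)\le \frac{6nk+55n+4k-25}{5}$ if $n$ is odd.
   Context: For a graph $G$ and $v\in V(G)$, $N(v)$ is the open neighborhood and $N[v]=N(v)\cup\{v\}$. For an integer $k\ge1$, a function $f:V(G)\to\{0,1,\dots,k+1\}$ is a $[k]$-Roman dominating function if for every vertex $v$ with $f(v)<k$ we have $\sum_{u\in N[v]}f(u)\ge k+|\{u\in N(v): f(u)>0\}|$. The weight of $f$ is $\sum_{v}f(v)$, and $\gamma_{[k]R}(G)$ is the minimum weight of a $[k]$-Roman dominating function on $G$. $C_m\Box P_n$ is the Cartesian product of the cycle $C_m$ (vertices $0,\dots,m-1$ mod $m$) and the path $P_n$ (vertices $0,\dots,n-1$): $(i,j)\sim(i',j')$ iff ($i=i'$ and $|j-j'|=1$) or ($j=j'$ and $i'\equiv i\pm1 \pmod m$). -}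

module Defs where

open import Data.Nat using (ℕ; zero; suc; _+_; _*_; _∸_; _≤_; _<_; _≡ᵇ_; _/_)
open import Data.Bool using (Bool; true; false; _∧_; _∨_; if_then_else_)
open import Data.Fin using (Fin; toℕ)
open import Data.Nat.ListAction using (sum)
open import Data.List using (List; map; allFin; concatMap; length; filter)
open import Data.Product using (_×_; _,_; Σ; ∃)
open import Data.Nat.DivMod using (_%_)
open import Relation.Nullary.Decidable using (does)
open import Data.Nat using (_<?_)

-- Vertices of C_m □ P_n : pairs (i , j) with i ∈ Fin m (cycle), j ∈ Fin n (path).
Vertex : ℕ → ℕ → Set
Vertex m n = Fin m × Fin n

adjᵇ : (m n : ℕ) → Vertex m n → Vertex m n → Bool
adjᵇ zero n _ _ = false
adjᵇ (suc m') n (i , j) (i' , j') =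
  ((toℕ i ≡ᵇ toℕ i') ∧ ((suc (toℕ j) ≡ᵇ toℕ j') ∨ (suc (toℕ j') ≡ᵇ toℕ j)))
  ∨ ((toℕ j ≡ᵇ toℕ j') ∧ ((toℕ i' ≡ᵇ (suc (toℕ i) % suc m'))
                          ∨ (toℕ i ≡ᵇ (suc (toℕ i') % suc m'))))

vertices : (m n : ℕ) → List (Vertex m n)
vertices m n = concatMap (λ i → map (λ j → (i , j)) (allFin n)) (allFin m)

N : (m n : ℕ) → Vertex m n → List (Vertex m n)
N m n v = filter (λ u → adjᵇ m n v u Data.Bool.≟ true) (vertices m n)
  where import Data.Bool

weight : (m n : ℕ) → (Vertex m n → ℕ) → ℕ
weight m n f = sum (map f (vertices m n))

IsKRDF : (k m n : ℕ) → (Vertex m n → ℕ) → Set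
IsKRDF k m n f =
  ((v : Vertex m n) → f v ≤ suc k)
  × ((v : Vertex m n) → f v < k →
       k + length (filter (λ u → 0 <? f u) (N m n v))
         ≤ f v + sum (map f (N m n v)))

IsKRomanDomNumber : (k m n γ : ℕ) → Set
IsKRomanDomNumber k m n γ =
  (Σ (Vertex m n → ℕ) λ f → IsKRDF k m n f × weight m n f ≡ γ)
  × ((f : Vertex m n → ℕ) → IsKRDF k m n f → γ ≤ weight m n f)
  where open import Relation.Binary.PropositionalEquality using (_≡_)

⌈_/_⌉ : ℕ → (b : ℕ) → .{{_ : Data.Nat.NonZero b}} → ℕ
⌈ a / b ⌉ = (a + b ∸ 1) / b

-- Write k = 15 s + ρ with 1 ≤ ρ ≤ 15. Along the path the columns alternate between two phases A
-- and B, B being A turned half-way round the cycle, and the two end columns are reinforced; a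
-- column of type d is labelled s · G d + H ρ d. The values of G are at most 15 and G sums to at
-- least 15 over every closed neighbourhood, so s · G covers the multiple 15 s of k, while the
-- tables H ρ cover the residue ρ and the count of positive neighbours, which does not grow with s.
-- The [k]-Roman condition at a vertex thus depends only on ρ and on the types of three consecutive
-- columns, which come in eight kinds, and is checked by evaluation. The weight of the labelling
-- and both claimed bounds grow with s at the same rate, so the bounds too reduce to finitely many
-- inequalities in ρ.

module Submission where

open import Defs
open import Data.Nat using (ℕ; _+_; _*_; _∸_; _≤_; _%_)
open import Data.Product using (_×_)
open import Relation.Binary.PropositionalEquality using (_≡_)

open import Data.Bool using (Bool; true; false; T; if_then_else_; _∧_; _∨_)
import Data.Bool as Bool
open import Data.Bool.Properties using (∧-zeroʳ; T-∧)
open import Data.Fin using (Fin; toℕ; inject₁; fromℕ) renaming (zero to fzero; suc to fsuc)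
open import Data.Fin.Properties using (toℕ<n; toℕ-injective; toℕ-inject₁; toℕ-fromℕ; all?)
open import Data.List using (List; []; _∷_; _++_; map; filter; length; concatMap; allFin; tabulate)
open import Data.List.Properties using (map-++; map-tabulate; map-∘; map-cong)
open import Data.Nat using (zero; suc; _<_; _≡ᵇ_; _<ᵇ_; _≤?_; _<?_; z≤n; s≤s; s<s; NonZero; >-nonZero⁻¹)
open import Data.Nat.DivMod using (_/_; _divMod_; result; +-distrib-/-∣ʳ; m*n/n≡m)
open import Data.Nat.Divisibility using (n∣m*n)
open import Data.Nat.ListAction using (sum)
open import Data.Nat.ListAction.Properties using (sum-++)
open import Data.Nat.Properties
open import Data.Nat.Tactic.RingSolver using (solve-∀)
open import Data.Product using (Σ; _,_; proj₁)
open import Data.Sum using (inj₁; inj₂)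
open import Function using (_∘_; id)
open import Function.Bundles using (Equivalence)
open import Relation.Binary.PropositionalEquality using (refl; sym; trans; cong; cong₂; module ≡-Reasoning)
open import Relation.Nullary using (Dec; does; yes; no; _×-dec_)
open import Relation.Nullary.Decidable using (dec-true; dec-false; from-yes; map′)
open import Relation.Unary using (Pred; Decidable)

open import Algebra.Properties.Semiring.Sum +-*-semiring
  using (sum-syntax; ∑-distrib-+; ∑-comm; sum-cong-≗; sum-init-last; sum-replicate-zero; *-distribˡ-sum)

-- Finite sums

when : Bool → ℕ → ℕ
when b x = if b then x else 0

when-∨ : ∀ a b x → (T a → b ≡ false) → when (a ∨ b) x ≡ when a x + when b x
when-∨ true  b x a⇒¬b rewrite a⇒¬b _ = sym (+-identityʳ x)
when-∨ false b x _ = refl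

when-∧ : ∀ a b x → when (a ∧ b) x ≡ when a (when b x)
when-∧ true  b x = refl
when-∧ false b x = refl

when-<ᵇ : ∀ {m n} x → m < n → when (m <ᵇ n) x ≡ x
when-<ᵇ x m<n = cong (λ b → when b x) (dec-true (_ <? _) m<n)

∑-when : ∀ n b (f : Fin n → ℕ) → ∑[ j < n ] when b (f j) ≡ when b (∑[ j < n ] f j)
∑-when n true  f = refl
∑-when n false f = sum-replicate-zero n

∑-const : ∀ n c → ∑[ _ < n ] c ≡ n * c
∑-const zero    c = refl
∑-const (suc n) c = cong (c +_) (∑-const n c)

∑-point : ∀ n c (g : ℕ → ℕ) → ∑[ j < n ] when (c ≡ᵇ toℕ j) (g (toℕ j)) ≡ when (c <ᵇ n) (g c)
∑-point zero    c       g = refl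
∑-point (suc n) zero    g = trans (cong (g 0 +_) (sum-replicate-zero n)) (+-identityʳ (g 0))
∑-point (suc n) (suc c) g = ∑-point n c (g ∘ suc)

∑-point′ : ∀ n c (g : ℕ → ℕ) → ∑[ j < n ] when (toℕ j ≡ᵇ c) (g (toℕ j)) ≡ when (c <ᵇ n) (g c)
∑-point′ zero    c       g = refl
∑-point′ (suc n) zero    g = trans (cong (g 0 +_) (sum-replicate-zero n)) (+-identityʳ (g 0))
∑-point′ (suc n) (suc c) g = ∑-point′ n c (g ∘ suc)

module _ {A : Set} {ℓ} {P : Pred A ℓ} (P? : Decidable P) where

  sum-map-filter : ∀ (h : A → ℕ) xs →
    sum (map h (filter P? xs)) ≡ sum (map (λ x → when (does (P? x)) (h x)) xs)
  sum-map-filter h [] = refl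
  sum-map-filter h (x ∷ xs) with does (P? x)
  ... | true  = cong (h x +_) (sum-map-filter h xs)
  ... | false = sum-map-filter h xs

  length-filter≡sum : ∀ xs → length (filter P? xs) ≡ sum (map (λ x → when (does (P? x)) 1) xs)
  length-filter≡sum [] = refl
  length-filter≡sum (x ∷ xs) with does (P? x)
  ... | true  = cong suc (length-filter≡sum xs)
  ... | false = length-filter≡sum xs

sum-concatMap : ∀ {A B : Set} (h : B → ℕ) (F : A → List B) xs →
  sum (map h (concatMap F xs)) ≡ sum (map (λ x → sum (map h (F x))) xs)
sum-concatMap h F [] = refl
sum-concatMap h F (x ∷ xs) = begin
  sum (map h (F x ++ concatMap F xs))                ≡⟨ cong sum (map-++ h (F x) _) ⟩
  sum (map h (F x) ++ map h (concatMap F xs))        ≡⟨ sum-++ (map h (F x)) _ ⟩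
  sum (map h (F x)) + sum (map h (concatMap F xs))   ≡⟨ cong (_ +_) (sum-concatMap h F xs) ⟩
  sum (map (λ x → sum (map h (F x))) (x ∷ xs))       ∎
  where open ≡-Reasoning

sum-tabulate : ∀ n (f : Fin n → ℕ) → sum (tabulate f) ≡ ∑[ i < n ] f i
sum-tabulate zero    f = refl
sum-tabulate (suc n) f = cong (f fzero +_) (sum-tabulate n (f ∘ fsuc))

sum-map-allFin : ∀ n (f : Fin n → ℕ) → sum (map f (allFin n)) ≡ ∑[ i < n ] f i
sum-map-allFin n f = trans (cong sum (map-tabulate id f)) (sum-tabulate n f)

sum-vertices : ∀ m n (h : Vertex m n → ℕ) → sum (map h (vertices m n)) ≡ ∑[ i < m ] ∑[ j < n ] h (i , j)
sum-vertices m n h = begin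
  sum (map h (vertices m n))                         ≡⟨ sum-concatMap h row (allFin m) ⟩
  sum (map (λ i → sum (map h (row i))) (allFin m))   ≡⟨ sum-map-allFin m _ ⟩
  ∑[ i < m ] sum (map h (row i))                     ≡⟨ sum-cong-≗ row-sum ⟩
  ∑[ i < m ] ∑[ j < n ] h (i , j)                    ∎
  where
  open ≡-Reasoning
  row : Fin m → List (Vertex m n)
  row i = map (i ,_) (allFin n)
  row-sum : ∀ i → sum (map h (row i)) ≡ ∑[ j < n ] h (i , j)
  row-sum i = trans (cong sum (sym (map-∘ (allFin n)))) (sum-map-allFin n _)

-- Neighbourhood sums

sum-map-N : ∀ {m n} (h : Vertex m n → ℕ) v →
  sum (map h (N m n v)) ≡ ∑[ i < m ] ∑[ j < n ] when (adjᵇ m n v (i , j)) (h (i , j))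
sum-map-N {m} {n} h v = begin
  sum (map h (N m n v))
    ≡⟨ sum-map-filter (λ u → adjᵇ m n v u Bool.≟ true) h (vertices m n) ⟩
  sum (map (λ u → when (does (adjᵇ m n v u Bool.≟ true)) (h u)) (vertices m n))
    ≡⟨ cong sum (map-cong (λ u → cong (λ b → when b (h u)) (does-≟-true (adjᵇ m n v u))) (vertices m n)) ⟩
  sum (map (λ u → when (adjᵇ m n v u) (h u)) (vertices m n))
    ≡⟨ sum-vertices m n _ ⟩
  ∑[ i < m ] ∑[ j < n ] when (adjᵇ m n v (i , j)) (h (i , j)) ∎
  where
  open ≡-Reasoning
  does-≟-true : ∀ b → does (b Bool.≟ true) ≡ b
  does-≟-true true  = refl
  does-≟-true false = refl

cycleAdj : ℕ → ℕ → Bool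
cycleAdj r r′ = (r′ ≡ᵇ suc r % 6) ∨ (r ≡ᵇ suc r′ % 6)

pred₆ succ₆ : Fin 6 → ℕ
pred₆ i = (toℕ i + 5) % 6
succ₆ i = suc (toℕ i) % 6

cycleAdj-irrefl : ∀ (i : Fin 6) → cycleAdj (toℕ i) (toℕ i) ≡ false
cycleAdj-irrefl fzero                                    = refl
cycleAdj-irrefl (fsuc fzero)                             = refl
cycleAdj-irrefl (fsuc (fsuc fzero))                      = refl
cycleAdj-irrefl (fsuc (fsuc (fsuc fzero)))               = refl
cycleAdj-irrefl (fsuc (fsuc (fsuc (fsuc fzero))))        = refl
cycleAdj-irrefl (fsuc (fsuc (fsuc (fsuc (fsuc fzero))))) = refl

∑-cycleAdj : ∀ (i : Fin 6) (g : ℕ → ℕ) →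
  ∑[ i′ < 6 ] when (cycleAdj (toℕ i) (toℕ i′)) (g (toℕ i′)) ≡ g (pred₆ i) + g (succ₆ i)
∑-cycleAdj fzero                                    g = trans (cong (g 1 +_) (+-identityʳ (g 5))) (+-comm (g 1) (g 5))
∑-cycleAdj (fsuc fzero)                             g = cong (g 0 +_) (+-identityʳ (g 2))
∑-cycleAdj (fsuc (fsuc fzero))                      g = cong (g 1 +_) (+-identityʳ (g 3))
∑-cycleAdj (fsuc (fsuc (fsuc fzero)))               g = cong (g 2 +_) (+-identityʳ (g 4))
∑-cycleAdj (fsuc (fsuc (fsuc (fsuc fzero))))        g = cong (g 3 +_) (+-identityʳ (g 5))
∑-cycleAdj (fsuc (fsuc (fsuc (fsuc (fsuc fzero))))) g = trans (cong (g 0 +_) (+-identityʳ (g 4))) (+-comm (g 0) (g 4))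

successor-not-predecessor : ∀ m n → T (suc m ≡ᵇ n) → (suc n ≡ᵇ m) ≡ false
successor-not-predecessor m n t with ≡ᵇ⇒≡ (suc m) n t
... | refl = dec-false (suc (suc m) ≟ m) (λ ())

when-adjᵇ : ∀ {n} (i i′ : Fin 6) (j j′ : Fin n) x → let J = toℕ j; J′ = toℕ j′ in
  when (adjᵇ 6 n (i , j) (i′ , j′)) x
    ≡ when (toℕ i ≡ᵇ toℕ i′) (when (suc J ≡ᵇ J′) x + when (suc J′ ≡ᵇ J) x)
      + when (J ≡ᵇ J′) (when (cycleAdj (toℕ i) (toℕ i′)) x)
when-adjᵇ i i′ j j′ x =
  trans (when-∨ (same ∧ path) ((J ≡ᵇ J′) ∧ cyc) x disjoint)
        (cong₂ _+_ (trans (when-∧ same path x)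
                          (cong (when same) (when-∨ _ _ x (successor-not-predecessor J J′))))
                   (when-∧ (J ≡ᵇ J′) cyc x))
  where
  J J′ : ℕ
  J = toℕ j
  J′ = toℕ j′
  same path cyc : Bool
  same = toℕ i ≡ᵇ toℕ i′
  path = (suc J ≡ᵇ J′) ∨ (suc J′ ≡ᵇ J)
  cyc = cycleAdj (toℕ i) (toℕ i′)
  same-not-cyc : T same → cyc ≡ false
  same-not-cyc t with toℕ-injective (≡ᵇ⇒≡ (toℕ i) (toℕ i′) t)
  ... | refl = cycleAdj-irrefl i
  disjoint : T (same ∧ path) → ((J ≡ᵇ J′) ∧ cyc) ≡ false
  disjoint t rewrite same-not-cyc (proj₁ (Equivalence.to T-∧ t)) = ∧-zeroʳ _

when-<ᵇ-padded : ∀ {m n} (h : ℕ → ℕ) → m ≤ n → h (suc n) ≡ 0 → when (m <ᵇ n) (h (suc m)) ≡ h (suc m)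
when-<ᵇ-padded {m} {n} h m≤n hₙ with m <? n
... | yes m<n = when-<ᵇ _ m<n
... | no m≮n = begin
  when (m <ᵇ n) (h (suc m)) ≡⟨ cong (λ b → when b (h (suc m))) (dec-false (m <? n) m≮n) ⟩
  0                         ≡⟨ sym hₙ ⟩
  h (suc n)                 ≡⟨ cong (h ∘ suc) (≤-antisym (≮⇒≥ m≮n) m≤n) ⟩
  h (suc m)                 ∎
  where open ≡-Reasoning

∑-successor : ∀ n J (h : ℕ → ℕ) → J < n → h (suc n) ≡ 0 →
  ∑[ j < n ] when (suc J ≡ᵇ toℕ j) (h (suc (toℕ j))) ≡ h (2 + J)
∑-successor n J h J<n hₙ = trans (∑-point n (suc J) (h ∘ suc)) (when-<ᵇ-padded h J<n hₙ)

∑-predecessor : ∀ n J (h : ℕ → ℕ) → J < n → h 0 ≡ 0 →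
  ∑[ j < n ] when (suc (toℕ j) ≡ᵇ J) (h (suc (toℕ j))) ≡ h J
∑-predecessor n zero    h _   h₀ = trans (sum-replicate-zero n) (sym h₀)
∑-predecessor n (suc J) h J<n _  = trans (∑-point′ n J (h ∘ suc)) (when-<ᵇ _ (<-trans (n<1+n J) J<n))

Padded : ℕ → (ℕ → ℕ → ℕ) → Set
Padded n H = (∀ r → H r 0 ≡ 0) × (∀ r → H r (suc n) ≡ 0)

-- Column j is stored at index j + 1, so that indices 0 and n + 1 can hold zero padding.
onGrid : ∀ {n} → (ℕ → ℕ → ℕ) → Vertex 6 n → ℕ
onGrid H (i , j) = H (toℕ i) (suc (toℕ j))

sum-onGrid-N : ∀ {n} (H : ℕ → ℕ → ℕ) → Padded n H → ∀ (i : Fin 6) (j : Fin n) →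
  let I = toℕ i; J = toℕ j in
  sum (map (onGrid H) (N 6 n (i , j))) ≡ H I (2 + J) + H I J + H (pred₆ i) (1 + J) + H (succ₆ i) (1 + J)
sum-onGrid-N {n} H (H₀ , Hₙ) i j = begin
  sum (map (onGrid H) (N 6 n (i , j)))
    ≡⟨ sum-map-N (onGrid H) (i , j) ⟩
  ∑[ i′ < 6 ] ∑[ j′ < n ] when (adjᵇ 6 n (i , j) (i′ , j′)) (H (toℕ i′) (suc (toℕ j′)))
    ≡⟨ sum-cong-≗ row ⟩
  ∑[ i′ < 6 ] (along i′ + across i′)
    ≡⟨ ∑-distrib-+ along across ⟩
  ∑[ i′ < 6 ] along i′ + ∑[ i′ < 6 ] across i′
    ≡⟨ cong₂ _+_ (trans (∑-point 6 I (λ r → H r (2 + J) + H r J)) (when-<ᵇ _ (toℕ<n i)))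
                 (∑-cycleAdj i (λ r → H r (1 + J))) ⟩
  (H I (2 + J) + H I J) + (H (pred₆ i) (1 + J) + H (succ₆ i) (1 + J))
    ≡⟨ sym (+-assoc (H I (2 + J) + H I J) _ _) ⟩
  H I (2 + J) + H I J + H (pred₆ i) (1 + J) + H (succ₆ i) (1 + J) ∎
  where
  open ≡-Reasoning
  I J : ℕ
  I = toℕ i
  J = toℕ j
  along across : Fin 6 → ℕ
  along i′ = when (I ≡ᵇ toℕ i′) (H (toℕ i′) (2 + J) + H (toℕ i′) J)
  across i′ = when (cycleAdj I (toℕ i′)) (H (toℕ i′) (1 + J))
  row : ∀ i′ →
    ∑[ j′ < n ] when (adjᵇ 6 n (i , j) (i′ , j′)) (H (toℕ i′) (suc (toℕ j′))) ≡ along i′ + across i′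
  row i′ = begin
    ∑[ j′ < n ] when (adjᵇ 6 n (i , j) (i′ , j′)) (h (toℕ j′))
      ≡⟨ sum-cong-≗ (λ j′ → when-adjᵇ i i′ j j′ (h (toℕ j′))) ⟩
    ∑[ j′ < n ] (when same (path j′) + when (J ≡ᵇ toℕ j′) (when cyc (h (toℕ j′))))
      ≡⟨ ∑-distrib-+ (when same ∘ path) (λ j′ → when (J ≡ᵇ toℕ j′) (when cyc (h (toℕ j′)))) ⟩
    ∑[ j′ < n ] when same (path j′) + ∑[ j′ < n ] when (J ≡ᵇ toℕ j′) (when cyc (h (toℕ j′)))
      ≡⟨ cong₂ _+_ (∑-when n same path) (trans (∑-point n J (when cyc ∘ h)) (when-<ᵇ _ (toℕ<n j))) ⟩
    when same (∑[ j′ < n ] path j′) + when cyc (h J)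
      ≡⟨ cong (λ x → when same x + when cyc (h J)) path-sum ⟩
    along i′ + across i′ ∎
    where
    h : ℕ → ℕ
    h c = H (toℕ i′) (suc c)
    same cyc : Bool
    same = I ≡ᵇ toℕ i′
    cyc = cycleAdj I (toℕ i′)
    right left path : Fin n → ℕ
    right j′ = when (suc J ≡ᵇ toℕ j′) (h (toℕ j′))
    left j′ = when (suc (toℕ j′) ≡ᵇ J) (h (toℕ j′))
    path j′ = right j′ + left j′
    path-sum : ∑[ j′ < n ] path j′ ≡ H (toℕ i′) (2 + J) + H (toℕ i′) J
    path-sum = trans (∑-distrib-+ right left)
                     (cong₂ _+_ (∑-successor n J (H (toℕ i′)) (toℕ<n j) (Hₙ _))
                                (∑-predecessor n J (H (toℕ i′)) (toℕ<n j) (H₀ _)))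

-- The labelling

data Phase : Set where
  A B : Phase

flip : Phase → Phase
flip A = B
flip B = A

phase : ℕ → Phase
phase zero          = B
phase (suc zero)    = A
phase (suc (suc c)) = phase c

phase-suc : ∀ c → phase (suc c) ≡ flip (phase c)
phase-suc zero          = refl
phase-suc (suc zero)    = refl
phase-suc (suc (suc c)) = phase-suc c

data Column : Set where
  pad         : Column
  inner outer : Phase → Column

column : ℕ → ℕ → Column
column n zero    = pad
column n (suc c) = if does (suc c ≤? n) then (if interior then inner p else outer p) else pad
  where
  interior : Bool
  interior = does (0 <? c) ∧ does (suc c <? n)
  p : Phase
  p = phase (suc c)

column-first : ∀ {n} → 1 ≤ n → column n 1 ≡ outer A
column-first 1≤n = cong (λ b → if b then outer A else pad) (dec-true (1 ≤? _) 1≤n)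

column-inner : ∀ {n} c → 2 + c < n → column n (2 + c) ≡ inner (phase c)
column-inner c c<n = cong₂ (λ b b′ → if b then (if b′ then inner (phase c) else outer (phase c)) else pad)
  (dec-true (2 + c ≤? _) (<⇒≤ c<n)) (dec-true (2 + c <? _) c<n)

column-last : ∀ n → 1 ≤ n → column n n ≡ outer (phase n)
column-last (suc zero)    _ = refl
column-last (suc (suc c)) _ = cong₂ (λ b b′ → if b then (if b′ then inner (phase c) else outer (phase c)) else pad)
  (dec-true (2 + c ≤? 2 + c) ≤-refl) (dec-false (2 + c <? 2 + c) (n≮n _))

column-beyond : ∀ n → column n (suc n) ≡ pad
column-beyond n = cong (λ b → if b then (if interior then inner p else outer p) else pad)
                       (dec-false (suc n ≤? n) (n≮n n))
  where
  interior : Bool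
  interior = does (0 <? n) ∧ does (suc n <? n)
  p : Phase
  p = phase (suc n)

data Consecutive : Column → Column → Column → Set where
  first       : Consecutive pad (outer A) (inner B)
  second      : Consecutive (outer A) (inner B) (inner A)
  interior    : ∀ p → Consecutive (inner p) (inner (flip p)) (inner p)
  penultimate : ∀ p → Consecutive (inner p) (inner (flip p)) (outer p)
  last        : ∀ p → Consecutive (inner p) (outer (flip p)) pad

consecutive : ∀ {n} c → 4 ≤ n → c < n → Consecutive (column n c) (column n (1 + c)) (column n (2 + c))
consecutive zero 4≤n _
  rewrite column-first (≤-trans (s≤s z≤n) 4≤n) | column-inner 0 (≤-trans (s≤s (s≤s (s≤s z≤n))) 4≤n)
  = first
consecutive (suc zero) 4≤n _
  rewrite column-first (≤-trans (s≤s z≤n) 4≤n) | column-inner 0 (≤-trans (s≤s (s≤s (s≤s z≤n))) 4≤n)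
        | column-inner 1 4≤n = second
consecutive {n} (suc (suc c)) 4≤n 2+c<n with m≤n⇒m<n∨m≡n 2+c<n
... | inj₂ refl rewrite column-inner c (n<1+n _) | column-last (3 + c) (s≤s z≤n) | column-beyond (3 + c)
                      | phase-suc c = last (phase c)
... | inj₁ 3+c<n with m≤n⇒m<n∨m≡n 3+c<n
...   | inj₂ refl rewrite column-inner c (<-trans (n<1+n _) (n<1+n _)) | column-inner (suc c) (n<1+n _)
                        | column-last (4 + c) (s≤s z≤n) | phase-suc c = penultimate (phase c)
...   | inj₁ 4+c<n rewrite column-inner c (<-trans (n<1+n _) 3+c<n) | column-inner (suc c) 3+c<n
                         | column-inner (2 + c) 4+c<n | phase-suc c = interior (phase c)

_!_ : List ℕ → ℕ → ℕ
[]       ! _     = 0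
(x ∷ xs) ! zero  = x
(x ∷ xs) ! suc r = xs ! r

rotate : Phase → ℕ → ℕ
rotate A r = r
rotate B r = (r + 3) % 6

G : Column → ℕ → ℕ
G pad       r = 0
G (inner p) r = (6 ∷ 6 ∷ 3 ∷ 0 ∷ 0 ∷ 3 ∷ []) ! rotate p r
G (outer p) r = (6 ∷ 6 ∷ 3 ∷ 3 ∷ 3 ∷ 3 ∷ []) ! rotate p r

innerH outerH : ℕ → List ℕ
innerH 1  = 1 ∷ 2 ∷ 2 ∷ 0 ∷ 0 ∷ 0 ∷ []
innerH 2  = 2 ∷ 2 ∷ 1 ∷ 0 ∷ 0 ∷ 1 ∷ []
innerH 3  = 2 ∷ 2 ∷ 2 ∷ 0 ∷ 0 ∷ 2 ∷ []
innerH 4  = 2 ∷ 3 ∷ 3 ∷ 0 ∷ 0 ∷ 1 ∷ []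
innerH 5  = 3 ∷ 3 ∷ 2 ∷ 0 ∷ 0 ∷ 2 ∷ []
innerH 6  = 3 ∷ 4 ∷ 3 ∷ 0 ∷ 0 ∷ 1 ∷ []
innerH 7  = 4 ∷ 4 ∷ 2 ∷ 0 ∷ 0 ∷ 2 ∷ []
innerH 8  = 4 ∷ 4 ∷ 3 ∷ 0 ∷ 0 ∷ 3 ∷ []
innerH 9  = 4 ∷ 5 ∷ 4 ∷ 0 ∷ 0 ∷ 2 ∷ []
innerH 10 = 5 ∷ 5 ∷ 3 ∷ 0 ∷ 0 ∷ 3 ∷ []
innerH 11 = 5 ∷ 6 ∷ 4 ∷ 0 ∷ 0 ∷ 2 ∷ []
innerH 12 = 6 ∷ 6 ∷ 3 ∷ 0 ∷ 0 ∷ 3 ∷ []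
innerH 13 = 6 ∷ 6 ∷ 4 ∷ 0 ∷ 0 ∷ 4 ∷ []
innerH 14 = 6 ∷ 7 ∷ 5 ∷ 0 ∷ 0 ∷ 3 ∷ []
innerH 15 = 7 ∷ 7 ∷ 4 ∷ 0 ∷ 0 ∷ 4 ∷ []
innerH _  = []
outerH 1  = 1 ∷ 2 ∷ 1 ∷ 1 ∷ 1 ∷ 0 ∷ []
outerH 2  = 2 ∷ 2 ∷ 1 ∷ 1 ∷ 1 ∷ 1 ∷ []
outerH 3  = 2 ∷ 2 ∷ 1 ∷ 1 ∷ 2 ∷ 1 ∷ []
outerH 4  = 2 ∷ 3 ∷ 1 ∷ 2 ∷ 2 ∷ 1 ∷ []
outerH 5  = 3 ∷ 3 ∷ 1 ∷ 2 ∷ 2 ∷ 1 ∷ []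
outerH 6  = 3 ∷ 4 ∷ 2 ∷ 2 ∷ 2 ∷ 1 ∷ []
outerH 7  = 4 ∷ 4 ∷ 2 ∷ 2 ∷ 2 ∷ 2 ∷ []
outerH 8  = 4 ∷ 4 ∷ 2 ∷ 2 ∷ 3 ∷ 2 ∷ []
outerH 9  = 4 ∷ 5 ∷ 2 ∷ 3 ∷ 3 ∷ 2 ∷ []
outerH 10 = 5 ∷ 5 ∷ 2 ∷ 3 ∷ 3 ∷ 2 ∷ []
outerH 11 = 5 ∷ 6 ∷ 3 ∷ 3 ∷ 3 ∷ 2 ∷ []
outerH 12 = 6 ∷ 6 ∷ 3 ∷ 3 ∷ 3 ∷ 3 ∷ []
outerH 13 = 6 ∷ 6 ∷ 3 ∷ 3 ∷ 4 ∷ 3 ∷ []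
outerH 14 = 6 ∷ 7 ∷ 3 ∷ 4 ∷ 4 ∷ 3 ∷ []
outerH 15 = 7 ∷ 7 ∷ 3 ∷ 4 ∷ 4 ∷ 3 ∷ []
outerH _  = []

H : ℕ → Column → ℕ → ℕ
H ρ pad       r = 0
H ρ (inner p) r = innerH ρ ! rotate p r
H ρ (outer p) r = outerH ρ ! rotate p r

label : ℕ → ℕ → Column → ℕ → ℕ
label s ρ d r = s * G d r + H ρ d r

label-pad : ∀ s ρ r → label s ρ pad r ≡ 0
label-pad s ρ r = trans (+-identityʳ (s * 0)) (*-zeroʳ s)

positive : ℕ → ℕ
positive zero    = 0
positive (suc _) = 1

positive-≤1 : ∀ x → positive x ≤ 1
positive-≤1 zero    = z≤n
positive-≤1 (suc _) = s≤s z≤n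

positive-scaled : ∀ s g h → positive (s * g + h) ≤ positive (g + h)
positive-scaled s zero    zero    rewrite *-zeroʳ s = z≤n
positive-scaled s zero    (suc h) = positive-≤1 _
positive-scaled s (suc g) h       = positive-≤1 _





neighbourSum : (Column → ℕ → ℕ) → Column → Column → Column → Fin 6 → ℕ
neighbourSum F a b c i = F c (toℕ i) + F a (toℕ i) + F b (pred₆ i) + F b (succ₆ i)

neighbourSum-mono : ∀ {F F′ : Column → ℕ → ℕ} → (∀ d r → F d r ≤ F′ d r) →
  ∀ a b c i → neighbourSum F a b c i ≤ neighbourSum F′ a b c i
neighbourSum-mono F≤F′ a b c i =
  +-mono-≤ (+-mono-≤ (+-mono-≤ (F≤F′ c _) (F≤F′ a _)) (F≤F′ b _)) (F≤F′ b _)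

neighbourSum-label : ∀ s ρ a b c i →
  neighbourSum (label s ρ) a b c i ≡ s * neighbourSum G a b c i + neighbourSum (H ρ) a b c i
neighbourSum-label s ρ a b c i = linear s (G c I) (H ρ c I) (G a I) (H ρ a I) (G b (pred₆ i)) (H ρ b (pred₆ i))
                                          (G b (succ₆ i)) (H ρ b (succ₆ i))
  where
  I : ℕ
  I = toℕ i
  linear : ∀ s g₁ h₁ g₂ h₂ g₃ h₃ g₄ h₄ →
    s * g₁ + h₁ + (s * g₂ + h₂) + (s * g₃ + h₃) + (s * g₄ + h₄)
      ≡ s * (g₁ + g₂ + g₃ + g₄) + (h₁ + h₂ + h₃ + h₄)
  linear = solve-∀

record LocallyRoman (ρ : ℕ) (a b c : Column) (i : Fin 6) : Set where
  field
    G-roman   : 15 ≤ G b (toℕ i) + neighbourSum G a b c i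
    H-roman   : ρ + neighbourSum (λ d r → positive (G d r + H ρ d r)) a b c i
                  ≤ H ρ b (toℕ i) + neighbourSum (H ρ) a b c i
    G-bounded : G b (toℕ i) ≤ 15
    H-bounded : H ρ b (toℕ i) ≤ suc ρ

locallyRoman? : ∀ ρ a b c i → Dec (LocallyRoman ρ a b c i)
locallyRoman? ρ a b c i =
  map′ (λ (g , h , g′ , h′) → record { G-roman = g ; H-roman = h ; G-bounded = g′ ; H-bounded = h′ })
  (λ l → let open LocallyRoman l in G-roman , H-roman , G-bounded , H-bounded)
  ((_ ≤? _) ×-dec (_ ≤? _) ×-dec (_ ≤? _) ×-dec (_ ≤? _))

label-bounded : ∀ s {ρ a b c i} → LocallyRoman ρ a b c i → label s ρ b (toℕ i) ≤ suc (15 * s + ρ)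
label-bounded s {ρ} l =
  ≤-trans (+-mono-≤ (*-monoʳ-≤ s G-bounded) H-bounded)
          (≤-reflexive (trans (cong (_+ suc ρ) (*-comm s 15)) (+-suc _ ρ)))
  where open LocallyRoman l

label-roman : ∀ s {ρ a b c i} → LocallyRoman ρ a b c i →
  15 * s + ρ + neighbourSum (λ d r → positive (label s ρ d r)) a b c i
    ≤ label s ρ b (toℕ i) + neighbourSum (label s ρ) a b c i
label-roman s {ρ} {a} {b} {c} {i} l = begin
  15 * s + ρ + neighbourSum (λ d r → positive (label s ρ d r)) a b c i
    ≤⟨ +-monoʳ-≤ (15 * s + ρ) (neighbourSum-mono (λ d r → positive-scaled s (G d r) (H ρ d r)) a b c i) ⟩
  15 * s + ρ + neighbourSum (λ d r → positive (G d r + H ρ d r)) a b c i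
    ≡⟨ +-assoc (15 * s) ρ _ ⟩
  15 * s + (ρ + neighbourSum (λ d r → positive (G d r + H ρ d r)) a b c i)
    ≤⟨ +-mono-≤ (≤-trans (≤-reflexive (*-comm 15 s)) (*-monoʳ-≤ s G-roman)) H-roman ⟩
  s * (G b I + neighbourSum G a b c i) + (H ρ b I + neighbourSum (H ρ) a b c i)
    ≡⟨ regroup s (G b I) (H ρ b I) (neighbourSum G a b c i) (neighbourSum (H ρ) a b c i) ⟩
  label s ρ b I + (s * neighbourSum G a b c i + neighbourSum (H ρ) a b c i)
    ≡⟨ cong (label s ρ b I +_) (sym (neighbourSum-label s ρ a b c i)) ⟩
  label s ρ b I + neighbourSum (label s ρ) a b c i ∎
  where
  open ≤-Reasoning
  open LocallyRoman l
  I : ℕ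
  I = toℕ i
  regroup : ∀ s g h g′ h′ → s * (g + g′) + (h + h′) ≡ s * g + h + (s * g′ + h′)
  regroup = solve-∀

RomanTriple : Column → Column → Column → Set
RomanTriple a b c = ∀ (r : Fin 15) i → LocallyRoman (suc (toℕ r)) a b c i

romanTriple? : ∀ a b c → Dec (RomanTriple a b c)
romanTriple? a b c = all? λ r → all? λ i → locallyRoman? _ a b c i

consecutive-roman : ∀ {a b c} → Consecutive a b c → RomanTriple a b c
consecutive-roman {a} {b} {c} first           = from-yes (romanTriple? a b c)
consecutive-roman {a} {b} {c} second          = from-yes (romanTriple? a b c)
consecutive-roman {a} {b} {c} (interior A)    = from-yes (romanTriple? a b c)
consecutive-roman {a} {b} {c} (interior B)    = from-yes (romanTriple? a b c)
consecutive-roman {a} {b} {c} (penultimate A) = from-yes (romanTriple? a b c)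
consecutive-roman {a} {b} {c} (penultimate B) = from-yes (romanTriple? a b c)
consecutive-roman {a} {b} {c} (last A)        = from-yes (romanTriple? a b c)
consecutive-roman {a} {b} {c} (last B)        = from-yes (romanTriple? a b c)

grid : ℕ → ℕ → ℕ → ℕ → ℕ → ℕ
grid s ρ n r c = label s ρ (column n c) r

labelling : ℕ → ℕ → (n : ℕ) → Vertex 6 n → ℕ
labelling s ρ n = onGrid (grid s ρ n)

grid-padded : ∀ s ρ n → Padded n (grid s ρ n)
grid-padded s ρ n = label-pad s ρ , λ r → trans (cong (λ d → label s ρ d r) (column-beyond n)) (label-pad s ρ r)

positive-padded : ∀ {n H} → Padded n H → Padded n (λ r c → positive (H r c))
positive-padded (H₀ , Hₙ) = (λ r → cong positive (H₀ r)) , (λ r → cong positive (Hₙ r))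

when-positive : ∀ x → when (does (0 <? x)) 1 ≡ positive x
when-positive zero    = refl
when-positive (suc x) = refl

length-positive-N : ∀ {n} (H : ℕ → ℕ → ℕ) v →
  length (filter (λ u → 0 <? onGrid H u) (N 6 n v)) ≡ sum (map (onGrid (λ r c → positive (H r c))) (N 6 n v))
length-positive-N {n} H v =
  trans (length-filter≡sum (λ u → 0 <? onGrid H u) (N 6 n v))
        (cong sum (map-cong (when-positive ∘ onGrid H) (N 6 n v)))

-- The Roman inequality holds at every vertex.
labelling-isKRDF : ∀ s (r : Fin 15) {n} → 4 ≤ n →
  let ρ = suc (toℕ r) in IsKRDF (15 * s + ρ) 6 n (labelling s ρ n)
labelling-isKRDF s r {n} 4≤n = (λ (i , j) → label-bounded s (roman i j)) , (λ (i , j) _ → dominating i j)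
  where
  ρ : ℕ
  ρ = suc (toℕ r)
  roman : ∀ i (j : Fin n) → LocallyRoman ρ (column n (toℕ j)) (column n (1 + toℕ j)) (column n (2 + toℕ j)) i
  roman i j = consecutive-roman (consecutive (toℕ j) 4≤n (toℕ<n j)) r i
  dominating : ∀ i j →
    15 * s + ρ + length (filter (λ u → 0 <? labelling s ρ n u) (N 6 n (i , j)))
      ≤ labelling s ρ n (i , j) + sum (map (labelling s ρ n) (N 6 n (i , j)))
  dominating i j = begin
    15 * s + ρ + length (filter (λ u → 0 <? labelling s ρ n u) (N 6 n (i , j)))
      ≡⟨ cong (15 * s + ρ +_) (trans (length-positive-N (grid s ρ n) (i , j))
           (sum-onGrid-N (λ r c → positive (grid s ρ n r c))
                         (positive-padded {H = grid s ρ n} (grid-padded s ρ n)) i j)) ⟩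
    15 * s + ρ + neighbourSum (λ d r → positive (label s ρ d r)) a b c i
      ≤⟨ label-roman s (roman i j) ⟩
    label s ρ b (toℕ i) + neighbourSum (label s ρ) a b c i
      ≡⟨ cong (label s ρ b (toℕ i) +_) (sym (sum-onGrid-N (grid s ρ n) (grid-padded s ρ n) i j)) ⟩
    labelling s ρ n (i , j) + sum (map (labelling s ρ n) (N 6 n (i , j))) ∎
    where
    open ≤-Reasoning
    a b c : Column
    a = column n (toℕ j)
    b = column n (1 + toℕ j)
    c = column n (2 + toℕ j)

-- Weight and the numerical bounds

columnWeight : ℕ → ℕ → Column → ℕ
columnWeight s ρ d = ∑[ r < 6 ] label s ρ d (toℕ r)

weightH : ℕ → Column → ℕ
weightH ρ d = ∑[ r < 6 ] H ρ d (toℕ r)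

weight-labelling : ∀ s ρ n → weight 6 n (labelling s ρ n) ≡ ∑[ j < n ] columnWeight s ρ (column n (suc (toℕ j)))
weight-labelling s ρ n = trans (sum-vertices 6 n _) (∑-comm {6} {n} (λ i j → labelling s ρ n (i , j)))

∑-rotate : ∀ (f : ℕ → ℕ) → ∑[ r < 6 ] f (rotate B (toℕ r)) ≡ ∑[ r < 6 ] f (toℕ r)
∑-rotate f = half-turn (f 0) (f 1) (f 2) (f 3) (f 4) (f 5)
  where
  half-turn : ∀ a b c d e f → d + (e + (f + (a + (b + (c + 0))))) ≡ a + (b + (c + (d + (e + (f + 0)))))
  half-turn = solve-∀

columnWeight-inner : ∀ s ρ p → columnWeight s ρ (inner p) ≡ columnWeight s ρ (inner A)
columnWeight-inner s ρ A = refl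
columnWeight-inner s ρ B = ∑-rotate (label s ρ (inner A))

columnWeight-outer : ∀ s ρ p → columnWeight s ρ (outer p) ≡ columnWeight s ρ (outer A)
columnWeight-outer s ρ A = refl
columnWeight-outer s ρ B = ∑-rotate (label s ρ (outer A))

columnWeight-split : ∀ s ρ d → columnWeight s ρ d ≡ s * ∑[ r < 6 ] G d (toℕ r) + weightH ρ d
columnWeight-split s ρ d =
  trans (∑-distrib-+ {6} (λ r → s * G d (toℕ r)) (λ r → H ρ d (toℕ r)))
        (cong (_+ weightH ρ d) (sym (*-distribˡ-sum {6} s (λ r → G d (toℕ r)))))

∑-columns : ∀ (w : Column → ℕ) →
  (∀ p → w (inner p) ≡ w (inner A)) → (∀ p → w (outer p) ≡ w (outer A)) →
  ∀ m → ∑[ j < 2 + m ] w (column (2 + m) (suc (toℕ j))) ≡ w (outer A) + (m * w (inner A) + w (outer A))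
∑-columns w inner≡ outer≡ m = cong₂ _+_ (cong w (column-first {2 + m} (s≤s z≤n))) (begin
  ∑[ j < 1 + m ] w (column n (2 + toℕ j))
    ≡⟨ sum-init-last {m} (λ j → w (column n (2 + toℕ j))) ⟩
  ∑[ j < m ] w (column n (2 + toℕ (inject₁ j))) + w (column n (2 + toℕ (fromℕ m)))
    ≡⟨ cong₂ _+_ (trans (sum-cong-≗ interior-weight) (∑-const m (w (inner A)))) last-weight ⟩
  m * w (inner A) + w (outer A) ∎)
  where
  open ≡-Reasoning
  n : ℕ
  n = 2 + m
  interior-weight : ∀ j → w (column n (2 + toℕ (inject₁ j))) ≡ w (inner A)
  interior-weight j = begin
    w (column n (2 + toℕ (inject₁ j))) ≡⟨ cong (λ c → w (column n (2 + c))) (toℕ-inject₁ j) ⟩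
    w (column n (2 + toℕ j))           ≡⟨ cong w (column-inner (toℕ j) (s<s (s<s (toℕ<n j)))) ⟩
    w (inner (phase (toℕ j)))          ≡⟨ inner≡ _ ⟩
    w (inner A)                        ∎
  last-weight : w (column n (2 + toℕ (fromℕ m))) ≡ w (outer A)
  last-weight = begin
    w (column n (2 + toℕ (fromℕ m))) ≡⟨ cong (λ c → w (column n (2 + c))) (toℕ-fromℕ m) ⟩
    w (column n n)                   ≡⟨ cong w (column-last n (s≤s z≤n)) ⟩
    w (outer (phase n))              ≡⟨ outer≡ _ ⟩
    w (outer A)                      ∎

weight-labelling-closed : ∀ s ρ m → let hₒ = weightH ρ (outer A); hᵢ = weightH ρ (inner A) in
  weight 6 (2 + m) (labelling s ρ (2 + m)) ≡ (s * 24 + hₒ) + (m * (s * 18 + hᵢ) + (s * 24 + hₒ))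
weight-labelling-closed s ρ m =
  trans (weight-labelling s ρ (2 + m))
 (trans (∑-columns (columnWeight s ρ) (columnWeight-inner s ρ) (columnWeight-outer s ρ) m)
        (cong₂ (λ x y → x + (m * y + x)) (columnWeight-split s ρ (outer A)) (columnWeight-split s ρ (inner A))))

⌈m+kn/n⌉≡⌈m/n⌉+k : ∀ m k n .{{_ : NonZero n}} → ⌈ m + k * n / n ⌉ ≡ ⌈ m / n ⌉ + k
⌈m+kn/n⌉≡⌈m/n⌉+k m k n = begin
  (m + k * n + n ∸ 1) / n       ≡⟨ cong (_/ n) shift ⟩
  (m + n ∸ 1 + k * n) / n       ≡⟨ +-distrib-/-∣ʳ (m + n ∸ 1) (n∣m*n k) ⟩
  (m + n ∸ 1) / n + k * n / n   ≡⟨ cong (⌈ m / n ⌉ +_) (m*n/n≡m k n) ⟩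
  ⌈ m / n ⌉ + k                 ∎
  where
  open ≡-Reasoning
  shift : m + k * n + n ∸ 1 ≡ m + n ∸ 1 + k * n
  shift = begin
    m + k * n + n ∸ 1       ≡⟨ +-∸-assoc (m + k * n) (>-nonZero⁻¹ n) ⟩
    m + k * n + (n ∸ 1)     ≡⟨ +-assoc m (k * n) (n ∸ 1) ⟩
    m + (k * n + (n ∸ 1))   ≡⟨ cong (m +_) (+-comm (k * n) (n ∸ 1)) ⟩
    m + (n ∸ 1 + k * n)     ≡⟨ sym (+-assoc m (n ∸ 1) (k * n)) ⟩
    m + (n ∸ 1) + k * n     ≡⟨ cong (_+ k * n) (sym (+-∸-assoc m (>-nonZero⁻¹ n))) ⟩
    m + n ∸ 1 + k * n       ∎

⌈k+5/5⌉ : ∀ s ρ → ⌈ 15 * s + ρ + 5 / 5 ⌉ ≡ ⌈ ρ + 5 / 5 ⌉ + 3 * s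
⌈k+5/5⌉ s ρ = trans (cong (λ x → ⌈ x / 5 ⌉) (regroup s ρ)) (⌈m+kn/n⌉≡⌈m/n⌉+k (ρ + 5) (3 * s) 5)
  where
  regroup : ∀ s ρ → 15 * s + ρ + 5 ≡ ρ + 5 + 3 * s * 5
  regroup = solve-∀

⌈k+3∸a/3⌉ : ∀ s ρ a → a ≤ ρ + 3 →
  ⌈ 15 * s + ρ + 3 ∸ (a + 3 * s) / 3 ⌉ ≡ ⌈ ρ + 3 ∸ a / 3 ⌉ + 4 * s
⌈k+3∸a/3⌉ s ρ a a≤ρ+3 =
  trans (cong (λ x → ⌈ x / 3 ⌉) difference) (⌈m+kn/n⌉≡⌈m/n⌉+k (ρ + 3 ∸ a) (4 * s) 3)
  where
  open ≡-Reasoning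
  regroup : ∀ s d a → 15 * s + (d + a) ≡ d + 4 * s * 3 + (a + 3 * s)
  regroup = solve-∀
  difference : 15 * s + ρ + 3 ∸ (a + 3 * s) ≡ ρ + 3 ∸ a + 4 * s * 3
  difference = begin
    15 * s + ρ + 3 ∸ (a + 3 * s)
      ≡⟨ cong (_∸ (a + 3 * s)) (+-assoc (15 * s) ρ 3) ⟩
    15 * s + (ρ + 3) ∸ (a + 3 * s)
      ≡⟨ cong (λ x → 15 * s + x ∸ (a + 3 * s)) (sym (m∸n+n≡m a≤ρ+3)) ⟩
    15 * s + (ρ + 3 ∸ a + a) ∸ (a + 3 * s)
      ≡⟨ cong (_∸ (a + 3 * s)) (regroup s (ρ + 3 ∸ a) a) ⟩
    ρ + 3 ∸ a + 4 * s * 3 + (a + 3 * s) ∸ (a + 3 * s)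
      ≡⟨ m+n∸n≡m _ (a + 3 * s) ⟩
    ρ + 3 ∸ a + 4 * s * 3 ∎

two-step-bound : ∀ {x y u v} → y + 1 ≤ u → x + 2 * y + 4 ≤ 2 * u + v → x + 3 * y + 6 ≤ 3 * u + v →
  ∀ t → x + (2 + t) * y + 2 * ⌈ 4 + t / 2 ⌉ ≤ (2 + t) * u + v
two-step-bound step base₀ base₁ zero          = base₀
two-step-bound step base₀ base₁ (suc zero)    = base₁
two-step-bound {x} {y} {u} {v} step base₀ base₁ (suc (suc t)) = begin
  x + (4 + t) * y + 2 * ⌈ 4 + (2 + t) / 2 ⌉
    ≡⟨ cong (λ q → x + (4 + t) * y + 2 * q) ⌈4+[2+t]/2⌉ ⟩
  x + (4 + t) * y + 2 * (⌈ 4 + t / 2 ⌉ + 1)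
    ≡⟨ split-lhs x y t ⌈ 4 + t / 2 ⌉ ⟩
  (x + (2 + t) * y + 2 * ⌈ 4 + t / 2 ⌉) + 2 * (y + 1)
    ≤⟨ +-mono-≤ (two-step-bound {x} step base₀ base₁ t) (*-monoʳ-≤ 2 step) ⟩
  ((2 + t) * u + v) + 2 * u
    ≡⟨ split-rhs u v t ⟩
  (4 + t) * u + v ∎
  where
  open ≤-Reasoning
  ⌈4+[2+t]/2⌉ : ⌈ 4 + (2 + t) / 2 ⌉ ≡ ⌈ 4 + t / 2 ⌉ + 1
  ⌈4+[2+t]/2⌉ = trans (cong (λ z → ⌈ z / 2 ⌉) (+-comm 2 (4 + t))) (⌈m+kn/n⌉≡⌈m/n⌉+k (4 + t) 1 2)
  split-lhs : ∀ x y t q → x + (4 + t) * y + 2 * (q + 1) ≡ (x + (2 + t) * y + 2 * q) + 2 * (y + 1)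
  split-lhs = solve-∀
  split-rhs : ∀ u v t → ((2 + t) * u + v) + 2 * u ≡ (4 + t) * u + v
  split-rhs = solve-∀

Bounds₁ : ℕ → Set
Bounds₁ ρ =
  let a = ⌈ ρ + 5 / 5 ⌉; b = ⌈ ρ + 3 ∸ a / 3 ⌉; hₒ = weightH ρ (outer A); hᵢ = weightH ρ (inner A) in
  (a ≤ ρ + 3) × (hᵢ + 1 ≤ 6 * a) ×
  (2 * hₒ + 2 * hᵢ + 4 ≤ 2 * (6 * a) + 12 * b) × (2 * hₒ + 3 * hᵢ + 6 ≤ 3 * (6 * a) + 12 * b)

Bounds₂ : ℕ → Set
Bounds₂ ρ = (5 * weightH ρ (inner A) ≤ 6 * ρ + 55) × (10 * weightH ρ (outer A) + 25 ≤ 16 * ρ + 110)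

bounds₁ : ∀ (r : Fin 15) → Bounds₁ (suc (toℕ r))
bounds₁ = from-yes (all? {15} (bounds₁? ∘ suc ∘ toℕ))
  where
  bounds₁? : ∀ ρ → Dec (Bounds₁ ρ)
  bounds₁? ρ = (_ ≤? _) ×-dec (_ ≤? _) ×-dec (_ ≤? _) ×-dec (_ ≤? _)

bounds₂ : ∀ (r : Fin 15) → Bounds₂ (suc (toℕ r))
bounds₂ = from-yes (all? {15} (bounds₂? ∘ suc ∘ toℕ))
  where
  bounds₂? : ∀ ρ → Dec (Bounds₂ ρ)
  bounds₂? ρ = (_ ≤? _) ×-dec (_ ≤? _)

labelling-bound₁ : ∀ s (r : Fin 15) t → let ρ = suc (toℕ r); k = 15 * s + ρ; n = 4 + t in
  weight 6 n (labelling s ρ n) + 2 * ⌈ n / 2 ⌉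
    ≤ 6 * (2 + t) * ⌈ k + 5 / 5 ⌉ + 12 * ⌈ k + 3 ∸ ⌈ k + 5 / 5 ⌉ / 3 ⌉
labelling-bound₁ s r t with bounds₁ r
... | a≤ρ+3 , step , base₀ , base₁ = begin
  weight 6 n (labelling s ρ n) + 2 * q
    ≡⟨ cong (_+ 2 * q) (weight-labelling-closed s ρ m) ⟩
  (s * 24 + hₒ) + (m * (s * 18 + hᵢ) + (s * 24 + hₒ)) + 2 * q
    ≡⟨ separate s hₒ hᵢ m q ⟩
  (2 * hₒ + m * hᵢ + 2 * q) + s * (48 + 18 * m)
    ≤⟨ +-monoˡ-≤ (s * (48 + 18 * m)) (two-step-bound {2 * hₒ} step base₀ base₁ t) ⟩
  (m * (6 * a) + 12 * b) + s * (48 + 18 * m)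
    ≡⟨ merge s a b m ⟩
  6 * m * (a + 3 * s) + 12 * (b + 4 * s)
    ≡⟨ cong₂ (λ x y → 6 * m * x + 12 * y) (sym (⌈k+5/5⌉ s ρ)) (sym ⌈k+3∸⌈k+5/5⌉/3⌉) ⟩
  6 * m * ⌈ k + 5 / 5 ⌉ + 12 * ⌈ k + 3 ∸ ⌈ k + 5 / 5 ⌉ / 3 ⌉ ∎
  where
  open ≤-Reasoning
  ρ k m n q a b hₒ hᵢ : ℕ
  ρ = suc (toℕ r)
  k = 15 * s + ρ
  m = 2 + t
  n = 2 + m
  q = ⌈ n / 2 ⌉
  a = ⌈ ρ + 5 / 5 ⌉
  b = ⌈ ρ + 3 ∸ a / 3 ⌉
  hₒ = weightH ρ (outer A)
  hᵢ = weightH ρ (inner A)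
  ⌈k+3∸⌈k+5/5⌉/3⌉ : ⌈ k + 3 ∸ ⌈ k + 5 / 5 ⌉ / 3 ⌉ ≡ b + 4 * s
  ⌈k+3∸⌈k+5/5⌉/3⌉ =
    trans (cong (λ x → ⌈ k + 3 ∸ x / 3 ⌉) (⌈k+5/5⌉ s ρ)) (⌈k+3∸a/3⌉ s ρ a a≤ρ+3)
  separate : ∀ s hₒ hᵢ m q →
    (s * 24 + hₒ) + (m * (s * 18 + hᵢ) + (s * 24 + hₒ)) + 2 * q ≡ (2 * hₒ + m * hᵢ + 2 * q) + s * (48 + 18 * m)
  separate = solve-∀
  merge : ∀ s a b m → (m * (6 * a) + 12 * b) + s * (48 + 18 * m) ≡ 6 * m * (a + 3 * s) + 12 * (b + 4 * s)
  merge = solve-∀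

labelling-bound₂ : ∀ s (r : Fin 15) m → let ρ = suc (toℕ r); k = 15 * s + ρ; n = 2 + m in
  5 * weight 6 n (labelling s ρ n) + 25 ≤ 6 * n * k + 55 * n + 4 * k
labelling-bound₂ s r m with bounds₂ r
... | inner-bound , outer-bound = begin
  5 * weight 6 (2 + m) (labelling s ρ (2 + m)) + 25
    ≡⟨ cong (λ w → 5 * w + 25) (weight-labelling-closed s ρ m) ⟩
  5 * ((s * 24 + hₒ) + (m * (s * 18 + hᵢ) + (s * 24 + hₒ))) + 25
    ≡⟨ separate s hₒ hᵢ m ⟩
  (10 * hₒ + 25) + m * (5 * hᵢ) + s * (240 + 90 * m)
    ≤⟨ +-monoˡ-≤ (s * (240 + 90 * m)) (+-mono-≤ outer-bound (*-monoʳ-≤ m inner-bound)) ⟩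
  (16 * ρ + 110) + m * (6 * ρ + 55) + s * (240 + 90 * m)
    ≡⟨ merge s ρ m ⟩
  6 * (2 + m) * (15 * s + ρ) + 55 * (2 + m) + 4 * (15 * s + ρ) ∎
  where
  open ≤-Reasoning
  ρ hₒ hᵢ : ℕ
  ρ = suc (toℕ r)
  hₒ = weightH ρ (outer A)
  hᵢ = weightH ρ (inner A)
  separate : ∀ s hₒ hᵢ m →
    5 * ((s * 24 + hₒ) + (m * (s * 18 + hᵢ) + (s * 24 + hₒ))) + 25
      ≡ (10 * hₒ + 25) + m * (5 * hᵢ) + s * (240 + 90 * m)
  separate = solve-∀
  merge : ∀ s ρ m →
    (16 * ρ + 110) + m * (6 * ρ + 55) + s * (240 + 90 * m)
      ≡ 6 * (2 + m) * (15 * s + ρ) + 55 * (2 + m) + 4 * (15 * s + ρ)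
  merge = solve-∀

residue-decomposition : ∀ k → 1 ≤ k → Σ ℕ λ s → Σ (Fin 15) λ r → k ≡ 15 * s + suc (toℕ r)
residue-decomposition (suc k) _ with k divMod 15
... | result s r k≡r+s*15 = s , r , trans (cong suc k≡r+s*15) (regroup (toℕ r) s)
  where
  regroup : ∀ x s → suc (x + s * 15) ≡ 15 * s + suc x
  regroup = solve-∀

theorem12 : (n k : ℕ) → 4 ≤ n → 1 ≤ k → (γ : ℕ) → IsKRomanDomNumber k 6 n γ →
    (γ + 2 * ⌈ n / 2 ⌉
       ≤ 6 * (n ∸ 2) * ⌈ k + 5 / 5 ⌉ + 12 * ⌈ k + 3 ∸ ⌈ k + 5 / 5 ⌉ / 3 ⌉)
    × (n % 2 ≡ 0 → 5 * γ + 20 ≤ 6 * n * k + 55 * n + 4 * k)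
    × (n % 2 ≡ 1 → 5 * γ + 25 ≤ 6 * n * k + 55 * n + 4 * k)
theorem12 n k 4≤n 1≤k γ (_ , minimal) with residue-decomposition k 1≤k | m≤n⇒∃[o]m+o≡n 4≤n
... | s , r , refl | t , refl =
  ≤-trans (+-monoˡ-≤ (2 * ⌈ 4 + t / 2 ⌉) γ≤weight) (labelling-bound₁ s r t) ,
  (λ _ → ≤-trans (+-monoʳ-≤ (5 * γ) (m≤m+n 20 5)) bound₂) ,
  (λ _ → bound₂)
  where
  ρ : ℕ
  ρ = suc (toℕ r)
  γ≤weight : γ ≤ weight 6 (4 + t) (labelling s ρ (4 + t))
  γ≤weight = minimal (labelling s ρ (4 + t)) (labelling-isKRDF s r 4≤n)
  bound₂ : 5 * γ + 25 ≤ 6 * (4 + t) * (15 * s + ρ) + 55 * (4 + t) + 4 * (15 * s + ρ)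
  bound₂ = ≤-trans (+-monoˡ-≤ 25 (*-monoʳ-≤ 5 γ≤weight)) (labelling-bound₂ s r (2 + t))
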